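{- Let $G=(V,E)$, $T$, $W$, monotone activation functions $f_{uv}$, the graph $G'$ and the sets $U_v$ be as in the context. Let $X$ be a vertex set with $T\subseteq X\subseteq V(G')$, and let $\mathcal{A}(X)$ be the family of vertex sets of those connected components of $G'[X]$ that contain at least one terminal. If $Y,Y'\in\mathcal{A}(X)$ with $Y\neq Y'$ and $Y\cap U_v\neq\emptyset$ for some $v\in V$, then $Y'\cap U_v=\emptyset$.
   Context: Steiner tree activation instance: an undirected graph $G=(V,E)$, terminals $T\subseteq V$, a finite set $W\subseteq\mathbb{R}_{\ge0}$, and for each edge $uv\in E$ a monotone activation function $f_{uv}:W\times W\to\{\top,\bot\}$ (i.e. $f_{uv}(i,j)=\top$, $i\le i'$, $j\le j'$ imply $f_{uv}(i',j')=\top$). The graph $G'$ has vertex set consisting of the terminals $T$ (as separate vertices) together with a copy $v_i$ for each $v\in V$ and $i\in W$; $u_i$ and $v_j$ are adjacent iff $uv\in E$ and $f_{uv}(i,j)=\top$, and each terminal $t\in T$ is adjacent to all its copies $t_i$, $i\in W$. For $v\in V$, $U_v=\{v_i: i\in W\}$. (Sets $X$ of this kind are those maintained during the increase phase of the Demaine–Hajiaghayi–Klein algorithm run on $G'$ starting from $X=T$.) -}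

module Defs where

open import Data.Nat using (ℕ)
open import Data.Fin using (Fin; _≤_)
open import Data.Fin.Subset using (Subset; _∈_)
open import Data.Bool using (Bool; true)
open import Data.Product using (Σ; _×_)
open import Relation.Binary.PropositionalEquality using (_≡_)

-- V = Fin n (vertices of G), W = Fin k : the finite value set W ⊆ ℝ≥0,
--   represented by the ranks of its k elements (order-isomorphic to W).
--   Activation values: true = ⊤, false = ⊥.
record Instance (n k : ℕ) : Set₁ where
  field
    E     : Fin n → Fin n → Set
    E-sym : ∀ {u v} → E u v → E v u
    T     : Subset n
    f     : Fin n → Fin n → Fin k → Fin k → Bool
    f-sym : ∀ u v i j → f u v i j ≡ f v u j i
    f-mon : ∀ u v {i i' j j'} → f u v i j ≡ true → i ≤ i' → j ≤ j' →
            f u v i' j' ≡ true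

module _ {n k : ℕ} (I : Instance n k) where
  open Instance I

  -- vertices of G' : terminals (as separate vertices) and copies v_i
  data Vert : Set where
    term : (t : Fin n) → t ∈ T → Vert
    copy : Fin n → Fin k → Vert

  data Adj : Vert → Vert → Set where
    cc : ∀ {u v i j} → E u v → f u v i j ≡ true → Adj (copy u i) (copy v j)
    tc : ∀ {t} (p : t ∈ T) (i : Fin k) → Adj (term t p) (copy t i)
    ct : ∀ {t} (p : t ∈ T) (i : Fin k) → Adj (copy t i) (term t p)

  data Conn (X : Vert → Set) (a : Vert) : Vert → Set where
    here : X a → Conn X a a
    step : ∀ {b c} → Conn X a b → Adj b c → X c → Conn X a c

  IsComponent : (X Y : Vert → Set) → Set
  IsComponent X Y = Σ Vert λ a → X a × (∀ b → (Y b → Conn X a b) × (Conn X a b → Y b))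

  InA : (X Y : Vert → Set) → Set
  InA X Y = IsComponent X Y × Σ (Fin n) λ t → Σ (t ∈ T) λ p → Y (term t p)

  TermsIn : (X : Vert → Set) → Set
  TermsIn X = ∀ t (p : t ∈ T) → X (term t p)

  SameSet : (Y Y' : Vert → Set) → Set
  SameSet Y Y' = ∀ b → (Y b → Y' b) × (Y' b → Y b)

-- Neighbourhoods in G' grow with the copy index: by monotonicity of f_uv, every
-- neighbour of v_i is a neighbour of v_j whenever i ≤ j. A path in G'[X] from a
-- terminal to v_i ends with an edge, so it can be redirected to any v_j ∈ X with
-- i ≤ j. Hence if a terminal component Y meets U_v in v_i and another component
-- Y' meets U_v in v_j, taking i ≤ j without loss of generality (Y' need not
-- contain a terminal for this), the terminal of Y reaches v_j ∈ Y', so Y = Y'.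
module Submission where

open import Defs
open import Data.Nat using (ℕ)
open import Data.Fin using (Fin; _≤_)
open import Data.Fin.Properties using (≤-total; ≤-refl)
open import Data.Product using (Σ; _,_; proj₁; proj₂)
open import Data.Sum using (inj₁; inj₂)
open import Relation.Nullary using (¬_)
open import Relation.Binary.PropositionalEquality using (trans; sym)

module _ {n k : ℕ} {I : Instance n k} where
  open Instance I

  Adj-sym : ∀ {a b} → Adj I a b → Adj I b a
  Adj-sym (cc {u} {v} {i} {j} e q) = cc (E-sym e) (trans (sym (f-sym u v i j)) q)
  Adj-sym (tc p i) = ct p i
  Adj-sym (ct p i) = tc p i

  Adj-monoʳ : ∀ {a v i j} → Adj I a (copy v i) → i ≤ j → Adj I a (copy v j)
  Adj-monoʳ (cc e q) i≤j = cc e (f-mon _ _ q ≤-refl i≤j)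
  Adj-monoʳ (tc p i) i≤j = tc p _

  SameSet-sym : ∀ {Y Y'} → SameSet I Y Y' → SameSet I Y' Y
  SameSet-sym Y≈Y' b = proj₂ (Y≈Y' b) , proj₁ (Y≈Y' b)

  module _ {X : Vert I → Set} where

    Conn-target : ∀ {a b} → Conn I X a b → X b
    Conn-target (here xb) = xb
    Conn-target (step _ _ xb) = xb

    Conn-trans : ∀ {a b c} → Conn I X a b → Conn I X b c → Conn I X a c
    Conn-trans a~b (here _) = a~b
    Conn-trans a~b (step b~c c-d xd) = step (Conn-trans a~b b~c) c-d xd

    Conn-sym : ∀ {a b} → Conn I X a b → Conn I X b a
    Conn-sym (here xa) = here xa
    Conn-sym (step a~b b-c xc) =
      Conn-trans (step (here xc) (Adj-sym b-c) (Conn-target a~b)) (Conn-sym a~b)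

    Conn-term-copy-mono : ∀ {t p v i j} → Conn I X (term t p) (copy v i) →
      i ≤ j → X (copy v j) → Conn I X (term t p) (copy v j)
    Conn-term-copy-mono (step t~b b-vi _) i≤j xvj = step t~b (Adj-monoʳ b-vi i≤j) xvj

    IsComponent-⊆ : ∀ {Y b} → IsComponent I X Y → Y b → X b
    IsComponent-⊆ (_ , _ , member) yb = Conn-target (proj₁ (member _) yb)

    IsComponent-connected : ∀ {Y b c} → IsComponent I X Y → Y b → Y c → Conn I X b c
    IsComponent-connected (_ , _ , member) yb yc =
      Conn-trans (Conn-sym (proj₁ (member _) yb)) (proj₁ (member _) yc)

    IsComponent-unique : ∀ {Y Y' b b'} → IsComponent I X Y → IsComponent I X Y' →
      Y b → Y' b' → Conn I X b b' → SameSet I Y Y'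
    IsComponent-unique {b = b} {b'} (a , _ , member) (a' , _ , member') yb y'b' b~b' c =
      (λ yc → proj₂ (member' c) (Conn-trans (Conn-sym a~a') (proj₁ (member c) yc))) ,
      (λ y'c → proj₂ (member c) (Conn-trans a~a' (proj₁ (member' c) y'c)))
      where
      a~a' : Conn I X a a'
      a~a' = Conn-trans (proj₁ (member b) yb)
               (Conn-trans b~b' (Conn-sym (proj₁ (member' b') y'b')))

    InA-copy-mono : ∀ {Y Y' v i j} → InA I X Y → IsComponent I X Y' →
      Y (copy v i) → Y' (copy v j) → i ≤ j → SameSet I Y Y'
    InA-copy-mono (cY , t , p , yt) cY' yvi y'vj i≤j =
      IsComponent-unique cY cY' yt y'vj
        (Conn-term-copy-mono (IsComponent-connected cY yt yvi) i≤j (IsComponent-⊆ cY' y'vj))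

lemma9 : {n k : ℕ} (I : Instance n k) (X Y Y' : Vert I → Set) →
    TermsIn I X → InA I X Y → InA I X Y' → ¬ SameSet I Y Y' →
    (v : Fin n) → Σ (Fin k) (λ i → Y (copy v i)) →
    ¬ Σ (Fin k) (λ j → Y' (copy v j))
lemma9 I X Y Y' _ Y∈A Y'∈A Y≉Y' v (i , yvi) (j , y'vj) with ≤-total i j
... | inj₁ i≤j = Y≉Y' (InA-copy-mono Y∈A (proj₁ Y'∈A) yvi y'vj i≤j)
... | inj₂ j≤i = Y≉Y' (SameSet-sym (InA-copy-mono Y'∈A (proj₁ Y∈A) y'vj yvi j≤i))
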